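{- Let $n>k$ be natural numbers such that $k$ divides $n$. Then every graph $G$ on $n$ vertices satisfies $h_k(G)\geqslant f_0(n,k)$.
   Context: All graphs are finite, undirected, without loops or multiple edges. For a graph $G$ and a natural number $k$, $h_k(G)$ denotes the number of unordered pairs of distinct vertices of $G$ whose degrees differ by less than $k$. For natural numbers $n>k$, $$f_0(n,k):=\left(\left\lceil \tfrac{n}{k} \right\rceil - 2\right)\binom{k}{2} + \binom{k+1}{2} + \binom{n-k \left( \left\lceil\frac{n}{k} \right\rceil - 1 \right)-1}{2},$$ where $\binom{m}{2}=m(m-1)/2$. -}

module Defs where

open import Data.Bool using (Bool; true; false; T)
open import Data.Nat using (ℕ; zero; suc; _+_; _*_; _∸_; _<_; NonZero)
open import Data.Nat.DivMod using (_/_)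
open import Data.Nat.Combinatorics using (_C_)
open import Data.Fin using (Fin; toℕ)
open import Data.List using (List; length; filterᵇ; allFin; cartesianProduct)
open import Data.Product using (_×_; _,_)
open import Relation.Binary.PropositionalEquality using (_≡_)
open import Relation.Nullary using (¬_)

record Graph (n : ℕ) : Set where
  field
    adj   : Fin n → Fin n → Bool
    sym   : ∀ i j → adj i j ≡ adj j i
    irrefl : ∀ i → adj i i ≡ false

open Graph public

degree : ∀ {n} → Graph n → Fin n → ℕ
degree {n} G i = length (filterᵇ (adj G i) (allFin n))

_<ᵇ'_ : ℕ → ℕ → Bool
zero  <ᵇ' zero  = false
zero  <ᵇ' suc _ = true
suc _ <ᵇ' zero  = false
suc m <ᵇ' suc n = m <ᵇ' n

dist : ℕ → ℕ → ℕ
dist m n = (m ∸ n) + (n ∸ m)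

-- h_k(G): number of unordered pairs {i,j}, i ≠ j (enumerated as toℕ i < toℕ j),
-- whose degrees differ by less than k
h : ∀ {n} → ℕ → Graph n → ℕ
h {n} k G = length (filterᵇ ok (cartesianProduct (allFin n) (allFin n)))
  where
  ok : Fin n × Fin n → Bool
  ok (i , j) with toℕ i <ᵇ' toℕ j
  ... | true  = dist (degree G i) (degree G j) <ᵇ' k
  ... | false = false

binom2 : ℕ → ℕ
binom2 m = m C 2

ceilDiv : (n k : ℕ) → .{{NonZero k}} → ℕ
ceilDiv n k = (n + k ∸ 1) / k

f0 : (n k : ℕ) → .{{NonZero k}} → ℕ
f0 n k = (ceilDiv n k ∸ 2) * binom2 k + binom2 (k + 1)
         + binom2 (n ∸ k * (ceilDiv n k ∸ 1) ∸ 1)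

{-# OPTIONS --safe #-}
-- Write n = q k and split the vertices by the window ⌊deg v / k⌋ ∈ [0, q).  Vertices in the same
-- window have degrees differing by less than k, so h_k(G) is at least the number of same-window
-- pairs, Σ_v C(c_v, 2) where c_v is the size of window v.  As Σ_v c_v = q k, the inequality
-- c² + k² ≥ 2 c k gives Σ_v C(c_v, 2) ≥ q C(k, 2) = f0(n, k) - 1, strictly unless every window
-- has exactly k vertices.  So h_k(G) < f0(n, k) forces every window to hold k vertices and every
-- two vertices in different windows to have degrees at least k apart.  Then, walking through the
-- intermediate windows, each vertex t of the top window has degree at least (q - 1) k more than
-- each vertex b of the bottom window; since t has at most n - k - 1 neighbours outside the bottom
-- window, t has more neighbours in the bottom window than b has neighbours at all.  Counting the
-- edges between the two windows from both sides makes this impossible.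
module Submission where

open import Data.Bool.Base using (Bool; true; false; T; _∧_)
open import Data.Empty using (⊥-elim)
open import Data.Fin.Base as Fin using (Fin; zero; suc; toℕ; fromℕ<)
open import Data.Fin.Properties using (_≟_; _<?_; <-cmp; all?; any?; ¬∀⟶∃¬; toℕ-fromℕ<)
open import Data.List.Base using (List; length; filterᵇ; tabulate; allFin; cartesianProduct; map; _++_)
open import Data.List.Properties using (filter-++; length-++; map-tabulate)
open import Data.Nat.Base
  using (ℕ; zero; suc; _+_; _*_; _∸_; _<_; _≤_; _<ᵇ_; _≡ᵇ_; z≤n; s≤s; z<s; NonZero; >-nonZero⁻¹)
open import Data.Nat.Combinatorics using (nCk+nC[k+1]≡[n+1]C[k+1]; nC1≡n)
open import Data.Nat.Divisibility using (_∣_; divides; n∣m*n)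
open import Data.Nat.DivMod
  using (_/_; _%_; m≡m%n+[m/n]*n; m%n<n; m/n*n≤m; /-monoˡ-≤; m<n*o⇒m/o<n; +-distrib-/-∣ˡ; m*n/n≡m; m<n⇒m/n≡0)
open import Data.Nat.Properties as ℕ using (+-identityʳ; ≤-refl)
open import Data.Nat.Tactic.RingSolver using (solve-∀)
open import Data.Product.Base using (∃; Σ-syntax; _×_; _,_; proj₁; proj₂)
open import Data.Sum.Base using (_⊎_; inj₁; inj₂; [_,_]′)
open import Defs renaming (sym to adj-sym)
open import Function.Base using (_∘_; id)
open import Relation.Binary.Definitions using (tri<; tri≈; tri>)
open import Relation.Binary.PropositionalEquality
  using (_≡_; _≢_; refl; sym; trans; cong; cong₂; subst; subst₂; module ≡-Reasoning)
open import Relation.Nullary.Decidable using (does; yes; no; T?; dec-true; dec-false; ¬?; _×-dec_)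
open import Relation.Nullary.Negation using (¬_)

open import Algebra.Properties.CommutativeSemigroup ℕ.*-commutativeSemigroup
  using () renaming (x∙yz≈y∙xz to x*[y*z]≡y*[x*z])
open import Algebra.Properties.Semiring.Sum ℕ.+-*-semiring
  using (sum; sum-syntax; sum-cong-≗; sum-replicate-zero; ∑-distrib-+; ∑-comm; *-distribˡ-sum; *-distribʳ-sum)

𝟙 : Bool → ℕ
𝟙 false = 0
𝟙 true  = 1

𝟙-mono : ∀ {a b} → (T a → T b) → 𝟙 a ≤ 𝟙 b
𝟙-mono {false}        _   = z≤n
𝟙-mono {true} {true}  _   = ≤-refl
𝟙-mono {true} {false} a⇒b = ⊥-elim (a⇒b _)

𝟙-< : ∀ {a b} → ¬ T a → T b → 𝟙 a < 𝟙 b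
𝟙-< {false} {true} _  _ = ≤-refl
𝟙-< {true}         ¬a _ = ⊥-elim (¬a _)

𝟙-pos : ∀ {a} → 0 < 𝟙 a → T a
𝟙-pos {true} _ = _

𝟙*-≤ : ∀ a x → 𝟙 a * x ≤ x
𝟙*-≤ false _ = z≤n
𝟙*-≤ true  x = ℕ.≤-reflexive (+-identityʳ x)

𝟙*𝟙*-mono : ∀ a b {x y} → (T a → T b → x ≤ y) → 𝟙 a * (𝟙 b * x) ≤ 𝟙 a * (𝟙 b * y)
𝟙*𝟙*-mono false _     _   = z≤n
𝟙*𝟙*-mono true  false _   = z≤n
𝟙*𝟙*-mono true  true  x≤y = ℕ.*-monoʳ-≤ 1 (ℕ.*-monoʳ-≤ 1 (x≤y _ _))

∧-monoʳ-T : ∀ a {b c} → (T b → T c) → T (a ∧ b) → T (a ∧ c)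
∧-monoʳ-T true  b⇒c = b⇒c
∧-monoʳ-T false _   = λ ()

≡ᵇ-refl : ∀ m → (m ≡ᵇ m) ≡ true
≡ᵇ-refl zero    = refl
≡ᵇ-refl (suc m) = ≡ᵇ-refl m

≡ᵇ-sym : ∀ m n → (m ≡ᵇ n) ≡ (n ≡ᵇ m)
≡ᵇ-sym zero    zero    = refl
≡ᵇ-sym zero    (suc n) = refl
≡ᵇ-sym (suc m) zero    = refl
≡ᵇ-sym (suc m) (suc n) = ≡ᵇ-sym m n

∑-const : ∀ n c → ∑[ i < n ] c ≡ n * c
∑-const zero    c = refl
∑-const (suc n) c = cong (c +_) (∑-const n c)

∑-mono-≤ : ∀ {n} {f g : Fin n → ℕ} → (∀ i → f i ≤ g i) → sum f ≤ sum g
∑-mono-≤ {zero}  f≤g = z≤n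
∑-mono-≤ {suc n} f≤g = ℕ.+-mono-≤ (f≤g zero) (∑-mono-≤ (f≤g ∘ suc))

∑-mono-< : ∀ {n} {f g : Fin n → ℕ} → (∀ i → f i ≤ g i) → ∀ i → f i < g i → sum f < sum g
∑-mono-< f≤g zero    fi<gi = ℕ.+-mono-<-≤ fi<gi (∑-mono-≤ (f≤g ∘ suc))
∑-mono-< f≤g (suc i) fi<gi = ℕ.+-mono-≤-< (f≤g zero) (∑-mono-< (f≤g ∘ suc) i fi<gi)

0<∑⇒∃0< : ∀ {n} (f : Fin n → ℕ) → 0 < sum f → ∃ λ i → 0 < f i
0<∑⇒∃0< {suc n} f 0<∑ with f zero in eq
... | suc _ = zero , subst (0 <_) (sym eq) z<s
... | zero with i , 0<fi ← 0<∑⇒∃0< (f ∘ suc) 0<∑ = suc i , 0<fi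

∑-𝟙≟ : ∀ {n} (i : Fin n) → ∑[ j < n ] 𝟙 (does (i ≟ j)) ≡ 1
∑-𝟙≟ {suc n} zero    = cong suc (sum-replicate-zero n)
∑-𝟙≟ {suc n} (suc i) = ∑-𝟙≟ i

∑-select : ∀ {q} m (g : ℕ → ℕ) → m < q → ∑[ v < q ] (𝟙 (m ≡ᵇ toℕ v) * g (toℕ v)) ≡ g m
∑-select {suc q} zero    g _         = trans (cong₂ _+_ (+-identityʳ (g 0)) (sum-replicate-zero q)) (+-identityʳ (g 0))
∑-select {suc q} (suc m) g (s≤s m<q) = ∑-select m (g ∘ suc) m<q

count : ∀ {n} → (Fin n → Bool) → ℕ
count {n} P = ∑[ i < n ] 𝟙 (P i)

sumOver : ∀ {n} → (Fin n → Bool) → (Fin n → ℕ) → ℕ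
sumOver {n} P x = ∑[ i < n ] (𝟙 (P i) * x i)

syntax sumOver P (λ i → x) = ∑[ i ∈ P ] x

∑∈-suc : ∀ {n} (P : Fin n → Bool) (x : Fin n → ℕ) → ∑[ i ∈ P ] suc (x i) ≡ count P + ∑[ i ∈ P ] x i
∑∈-suc P x = trans (sum-cong-≗ (λ i → ℕ.*-suc (𝟙 (P i)) (x i))) (∑-distrib-+ (𝟙 ∘ P) (λ i → 𝟙 (P i) * x i))

∑∈-cross-≤ : ∀ {n} (P Q : Fin n → Bool) (x y : Fin n → ℕ) → (∀ {i j} → T (P i) → T (Q j) → x j ≤ y i) →
  count P * ∑[ j ∈ Q ] x j ≤ count Q * ∑[ i ∈ P ] y i
∑∈-cross-≤ {n} P Q x y x≤y = begin
  count P * ∑[ j ∈ Q ] x j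
    ≡⟨ *-distribʳ-sum (∑[ j ∈ Q ] x j) (𝟙 ∘ P) ⟩
  ∑[ i < n ] (𝟙 (P i) * ∑[ j ∈ Q ] x j)
    ≡⟨ sum-cong-≗ (λ i → *-distribˡ-sum (𝟙 (P i)) (λ j → 𝟙 (Q j) * x j)) ⟩
  ∑[ i < n ] ∑[ j < n ] (𝟙 (P i) * (𝟙 (Q j) * x j))
    ≤⟨ ∑-mono-≤ (λ i → ∑-mono-≤ λ j → 𝟙*𝟙*-mono (P i) (Q j) x≤y) ⟩
  ∑[ i < n ] ∑[ j < n ] (𝟙 (P i) * (𝟙 (Q j) * y i))
    ≡⟨ sum-cong-≗ factor ⟩
  ∑[ i < n ] (count Q * (𝟙 (P i) * y i))
    ≡⟨ *-distribˡ-sum (count Q) (λ i → 𝟙 (P i) * y i) ⟨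
  count Q * ∑[ i ∈ P ] y i ∎
  where
  open ℕ.≤-Reasoning
  factor : ∀ i → ∑[ j < n ] (𝟙 (P i) * (𝟙 (Q j) * y i)) ≡ count Q * (𝟙 (P i) * y i)
  factor i = begin-equality
    ∑[ j < n ] (𝟙 (P i) * (𝟙 (Q j) * y i)) ≡⟨ *-distribˡ-sum (𝟙 (P i)) (λ j → 𝟙 (Q j) * y i) ⟨
    𝟙 (P i) * ∑[ j < n ] (𝟙 (Q j) * y i)   ≡⟨ cong (𝟙 (P i) *_) (*-distribʳ-sum (y i) (𝟙 ∘ Q)) ⟨
    𝟙 (P i) * (count Q * y i)             ≡⟨ x*[y*z]≡y*[x*z] (𝟙 (P i)) (count Q) (y i) ⟩
    count Q * (𝟙 (P i) * y i)             ∎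

-- Fibres of a bounded map

fibreSize : ∀ {n} → (Fin n → ℕ) → ℕ → ℕ
fibreSize w v = count (λ i → w i ≡ᵇ v)

fibre-inhabited : ∀ {n} (w : Fin n → ℕ) {v} → 0 < fibreSize w v → ∃ λ i → w i ≡ v
fibre-inhabited w {v} 0<size with i , 0<𝟙 ← 0<∑⇒∃0< _ 0<size = i , ℕ.≡ᵇ⇒≡ (w i) v (𝟙-pos 0<𝟙)

module _ {n q} (w : Fin n → ℕ) (w<q : ∀ i → w i < q) where

  ∑-fibres : ∀ (g : ℕ → ℕ) → ∑[ i < n ] g (w i) ≡ ∑[ v < q ] (fibreSize w (toℕ v) * g (toℕ v))
  ∑-fibres g = begin
    ∑[ i < n ] g (w i)
      ≡⟨ sum-cong-≗ (λ i → sym (∑-select (w i) g (w<q i))) ⟩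
    ∑[ i < n ] ∑[ v < q ] (𝟙 (w i ≡ᵇ toℕ v) * g (toℕ v))
      ≡⟨ ∑-comm (λ (i : Fin n) (v : Fin q) → 𝟙 (w i ≡ᵇ toℕ v) * g (toℕ v)) ⟩
    ∑[ v < q ] ∑[ i < n ] (𝟙 (w i ≡ᵇ toℕ v) * g (toℕ v))
      ≡⟨ sum-cong-≗ (λ (v : Fin q) → sym (*-distribʳ-sum (g (toℕ v)) (λ (i : Fin n) → 𝟙 (w i ≡ᵇ toℕ v)))) ⟩
    ∑[ v < q ] (fibreSize w (toℕ v) * g (toℕ v)) ∎
    where open ≡-Reasoning

  ∑-fibreSize : ∑[ v < q ] fibreSize w (toℕ v) ≡ n
  ∑-fibreSize = begin
    ∑[ v < q ] fibreSize w (toℕ v)       ≡⟨ sum-cong-≗ (λ (v : Fin q) → sym (ℕ.*-identityʳ (fibreSize w (toℕ v)))) ⟩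
    ∑[ v < q ] (fibreSize w (toℕ v) * 1) ≡⟨ ∑-fibres (λ _ → 1) ⟨
    ∑[ i < n ] 1                         ≡⟨ trans (∑-const n 1) (ℕ.*-identityʳ n) ⟩
    n                                    ∎
    where open ≡-Reasoning

  ∑∑-sameFibre : ∑[ i < n ] ∑[ j < n ] 𝟙 (w i ≡ᵇ w j) ≡ ∑[ v < q ] (fibreSize w (toℕ v) * fibreSize w (toℕ v))
  ∑∑-sameFibre = trans (∑-comm (λ (i j : Fin n) → 𝟙 (w i ≡ᵇ w j))) (∑-fibres (fibreSize w))

-- Counting unordered pairs

pairCount : ∀ {n} → (Fin n → Fin n → Bool) → ℕ
pairCount {n} R = ∑[ i < n ] ∑[ j < n ] 𝟙 (does (i <? j) ∧ R i j)

module _ {n} {R S : Fin n → Fin n → Bool} (R⇒S : ∀ {i j} → T (R i j) → T (S i j)) where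

  private
    pointwise : ∀ i j → 𝟙 (does (i <? j) ∧ R i j) ≤ 𝟙 (does (i <? j) ∧ S i j)
    pointwise i j = 𝟙-mono (∧-monoʳ-T (does (i <? j)) R⇒S)

    strictAt : ∀ {i j} → i Fin.< j → ¬ T (R i j) → T (S i j) → pairCount R < pairCount S
    strictAt {i} {j} i<j ¬Rij Sij = ∑-mono-< (λ i → ∑-mono-≤ (pointwise i)) i (∑-mono-< (pointwise i) j strict)
      where
      strict : 𝟙 (does (i <? j) ∧ R i j) < 𝟙 (does (i <? j) ∧ S i j)
      strict rewrite dec-true (i <? j) i<j = 𝟙-< ¬Rij Sij

  pairCount-mono : pairCount R ≤ pairCount S
  pairCount-mono = ∑-mono-≤ λ i → ∑-mono-≤ (pointwise i)

  pairCount-mono-< : (∀ i j → R i j ≡ R j i) → (∀ i j → S i j ≡ S j i) →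
    ∀ {i j} → i ≢ j → ¬ T (R i j) → T (S i j) → pairCount R < pairCount S
  pairCount-mono-< R-sym S-sym {i} {j} i≢j ¬Rij Sij with <-cmp i j
  ... | tri< i<j _ _ = strictAt i<j ¬Rij Sij
  ... | tri≈ _ i≡j _ = ⊥-elim (i≢j i≡j)
  ... | tri> _ _ j<i = strictAt j<i (subst (¬_ ∘ T) (R-sym i j) ¬Rij) (subst T (S-sym i j) Sij)

module _ {n} {R : Fin n → Fin n → Bool} (R-sym : ∀ i j → R i j ≡ R j i) (R-refl : ∀ i → R i i ≡ true) where

  private
    below above diagonal : Fin n → Fin n → ℕ
    below    i j = 𝟙 (does (i <? j) ∧ R i j)
    above    i j = 𝟙 (does (j <? i) ∧ R j i)
    diagonal i j = 𝟙 (does (i ≟ j))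

    split : ∀ i j → 𝟙 (R i j) ≡ below i j + above i j + diagonal i j
    split i j with <-cmp i j
    ... | tri< i<j i≢j j≮i rewrite dec-true (i <? j) i<j | dec-false (j <? i) j≮i | dec-false (i ≟ j) i≢j =
      sym (trans (+-identityʳ _) (+-identityʳ _))
    ... | tri> i≮j i≢j j<i rewrite dec-false (i <? j) i≮j | dec-true (j <? i) j<i | dec-false (i ≟ j) i≢j =
      trans (cong 𝟙 (R-sym i j)) (sym (+-identityʳ _))
    ... | tri≈ _ refl i≮i rewrite dec-false (i <? i) i≮i | dec-true (i ≟ i) refl | R-refl i = refl

  ∑∑≡2*pairCount+n : ∑[ i < n ] ∑[ j < n ] 𝟙 (R i j) ≡ 2 * pairCount R + n
  ∑∑≡2*pairCount+n = begin
    ∑[ i < n ] ∑[ j < n ] 𝟙 (R i j)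
      ≡⟨ sum-cong-≗ (λ i → sum-cong-≗ (split i)) ⟩
    ∑[ i < n ] ∑[ j < n ] (below i j + above i j + diagonal i j)
      ≡⟨ sum-cong-≗ (λ i → trans (∑-distrib-+ (λ j → below i j + above i j) (diagonal i))
                                  (cong₂ _+_ (∑-distrib-+ (below i) (above i)) (∑-𝟙≟ i))) ⟩
    ∑[ i < n ] (sum (below i) + sum (above i) + 1)
      ≡⟨ trans (∑-distrib-+ (λ i → sum (below i) + sum (above i)) (λ _ → 1))
               (cong₂ _+_ (∑-distrib-+ (sum ∘ below) (sum ∘ above)) (trans (∑-const n 1) (ℕ.*-identityʳ n))) ⟩
    pairCount R + ∑[ i < n ] ∑[ j < n ] above i j + n
      ≡⟨ cong (λ x → pairCount R + x + n) (∑-comm above) ⟩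
    pairCount R + pairCount R + n
      ≡⟨ cong (λ x → pairCount R + x + n) (+-identityʳ (pairCount R)) ⟨
    2 * pairCount R + n ∎
    where open ≡-Reasoning

dist-comm : ∀ m n → dist m n ≡ dist n m
dist-comm m n = ℕ.+-comm (m ∸ n) (n ∸ m)

dist-+ : ∀ m t → dist m (m + t) ≡ t
dist-+ m t = cong₂ _+_ (ℕ.m≤n⇒m∸n≡0 (ℕ.m≤m+n m t)) (ℕ.m+n∸m≡n m t)

private
  dist-square-≤ : ∀ {a b} → a ≤ b → 2 * (a * b) + dist a b * dist a b ≡ a * a + b * b
  dist-square-≤ {a} a≤b with t , refl ← ℕ.m≤n⇒∃[o]m+o≡n a≤b rewrite dist-+ a t = expand a t
    where
    expand : ∀ a t → 2 * (a * (a + t)) + t * t ≡ a * a + (a + t) * (a + t)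
    expand = solve-∀

dist-square : ∀ a b → 2 * (a * b) + dist a b * dist a b ≡ a * a + b * b
dist-square a b with ℕ.≤-total a b
... | inj₁ a≤b = dist-square-≤ a≤b
... | inj₂ b≤a = begin
  2 * (a * b) + dist a b * dist a b ≡⟨ cong₂ (λ x y → 2 * x + y * y) (ℕ.*-comm a b) (dist-comm a b) ⟩
  2 * (b * a) + dist b a * dist b a ≡⟨ dist-square-≤ b≤a ⟩
  b * b + a * a                     ≡⟨ ℕ.+-comm (b * b) (a * a) ⟩
  a * a + b * b                     ∎
  where open ≡-Reasoning

≢⇒0<dist : ∀ {a b} → a ≢ b → 0 < dist a b
≢⇒0<dist {a} {b} a≢b with ℕ.<-cmp a b
... | tri< a<b _ _ = ℕ.<-≤-trans (ℕ.m<n⇒0<n∸m a<b) (ℕ.m≤n+m (b ∸ a) (a ∸ b))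
... | tri≈ _ a≡b _ = ⊥-elim (a≢b a≡b)
... | tri> _ _ b<a = ℕ.<-≤-trans (ℕ.m<n⇒0<n∸m b<a) (ℕ.m≤m+n (a ∸ b) (b ∸ a))

0<m⇒0<m*m : ∀ {m} → 0 < m → 0 < m * m
0<m⇒0<m*m {suc _} _ = z<s

am-gm : ∀ a b → 2 * (a * b) ≤ a * a + b * b
am-gm a b = subst (2 * (a * b) ≤_) (dist-square a b) (ℕ.m≤m+n _ _)

am-gm-< : ∀ {a b} → a ≢ b → 2 * (a * b) < a * a + b * b
am-gm-< {a} {b} a≢b = subst (2 * (a * b) <_) (dist-square a b) (ℕ.m<m+n _ (0<m⇒0<m*m (≢⇒0<dist a≢b)))

module _ {q k} (c : Fin q → ℕ) (∑c≡qk : sum c ≡ q * k) where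

  private
    ∑-cross : ∑[ v < q ] (2 * (c v * k)) ≡ q * (k * k) + q * (k * k)
    ∑-cross = begin
      ∑[ v < q ] (2 * (c v * k)) ≡⟨ *-distribˡ-sum 2 (λ v → c v * k) ⟨
      2 * ∑[ v < q ] (c v * k)   ≡⟨ cong (2 *_) (*-distribʳ-sum k c) ⟨
      2 * (sum c * k)            ≡⟨ cong (λ s → 2 * (s * k)) ∑c≡qk ⟩
      2 * (q * k * k)            ≡⟨ rearrange q k ⟩
      q * (k * k) + q * (k * k)  ∎
      where
      open ≡-Reasoning
      rearrange : ∀ q k → 2 * (q * k * k) ≡ q * (k * k) + q * (k * k)
      rearrange = solve-∀

    ∑-squares+const : ∑[ v < q ] (c v * c v + k * k) ≡ ∑[ v < q ] (c v * c v) + q * (k * k)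
    ∑-squares+const = trans (∑-distrib-+ (λ v → c v * c v) (λ _ → k * k)) (cong (_ +_) (∑-const q (k * k)))

  ∑-squares-≥ : q * (k * k) ≤ ∑[ v < q ] (c v * c v)
  ∑-squares-≥ = ℕ.+-cancelʳ-≤ (q * (k * k)) _ _
    (subst₂ _≤_ ∑-cross ∑-squares+const (∑-mono-≤ λ v → am-gm (c v) k))

  ∑-squares-> : ∀ v → c v ≢ k → q * (k * k) < ∑[ v < q ] (c v * c v)
  ∑-squares-> v cv≢k = ℕ.+-cancelʳ-< (q * (k * k)) _ _
    (subst₂ _<_ ∑-cross ∑-squares+const (∑-mono-< (λ v → am-gm (c v) k) v (am-gm-< cv≢k)))

binom2-suc : ∀ m → binom2 (suc m) ≡ m + binom2 m
binom2-suc m = trans (sym (nCk+nC[k+1]≡[n+1]C[k+1] m 1)) (cong (_+ binom2 m) (nC1≡n m))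

2*binom2+n≡n*n : ∀ n → 2 * binom2 n + n ≡ n * n
2*binom2+n≡n*n zero    = refl
2*binom2+n≡n*n (suc n) = begin
  2 * binom2 (suc n) + suc n     ≡⟨ cong (λ b → 2 * b + suc n) (binom2-suc n) ⟩
  2 * (n + binom2 n) + suc n     ≡⟨ rearrange n (binom2 n) ⟩
  2 * binom2 n + n + suc (n + n) ≡⟨ cong (_+ suc (n + n)) (2*binom2+n≡n*n n) ⟩
  n * n + suc (n + n)            ≡⟨ expand n ⟩
  suc n * suc n                  ∎
  where
  open ≡-Reasoning
  rearrange : ∀ n b → 2 * (n + b) + suc n ≡ 2 * b + n + suc (n + n)
  rearrange = solve-∀
  expand : ∀ n → n * n + suc (n + n) ≡ suc n * suc n
  expand = solve-∀

module _ (q k p : ℕ) where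

  private
    q*k*k≡ : q * (k * k) ≡ 2 * (q * binom2 k) + q * k
    q*k*k≡ = trans (cong (q *_) (sym (2*binom2+n≡n*n k))) (distribute q (binom2 k) k)
      where
      distribute : ∀ q b k → q * (2 * b + k) ≡ 2 * (q * b) + q * k
      distribute = solve-∀

  q*binom2≤ : q * (k * k) ≤ 2 * p + q * k → q * binom2 k ≤ p
  q*binom2≤ le = ℕ.*-cancelˡ-≤ 2 (ℕ.+-cancelʳ-≤ (q * k) _ _ (subst (_≤ 2 * p + q * k) q*k*k≡ le))

  q*binom2< : q * (k * k) < 2 * p + q * k → q * binom2 k < p
  q*binom2< lt = ℕ.*-cancelˡ-< 2 _ _ (ℕ.+-cancelʳ-< (q * k) _ _ (subst (_< 2 * p + q * k) q*k*k≡ lt))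

module _ {k} .{{_ : NonZero k}} where

  private
    same-quotient⇒< : ∀ {x y} → x ≤ y → x / k ≡ y / k → y < x + k
    same-quotient⇒< {x} {y} x≤y x/k≡y/k = begin-strict
      y                   ≡⟨ m≡m%n+[m/n]*n y k ⟩
      y % k + (y / k) * k <⟨ ℕ.+-monoˡ-< _ (m%n<n y k) ⟩
      k + (y / k) * k     ≡⟨ cong (λ z → k + z * k) x/k≡y/k ⟨
      k + (x / k) * k     ≤⟨ ℕ.+-monoʳ-≤ k (m/n*n≤m x k) ⟩
      k + x               ≡⟨ ℕ.+-comm k x ⟩
      x + k               ∎
      where open ℕ.≤-Reasoning

    same-quotient⇒dist<-≤ : ∀ {x y} → x ≤ y → x / k ≡ y / k → dist x y < k
    same-quotient⇒dist<-≤ {x} x≤y eq with t , refl ← ℕ.m≤n⇒∃[o]m+o≡n x≤y rewrite dist-+ x t =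
      ℕ.+-cancelˡ-< x t k (same-quotient⇒< x≤y eq)

  same-quotient⇒dist< : ∀ x y → x / k ≡ y / k → dist x y < k
  same-quotient⇒dist< x y eq with ℕ.≤-total x y
  ... | inj₁ x≤y = same-quotient⇒dist<-≤ x≤y eq
  ... | inj₂ y≤x = subst (_< k) (dist-comm y x) (same-quotient⇒dist<-≤ y≤x (sym eq))

  quotient-<⇒< : ∀ {x y} → x / k < y / k → x < y
  quotient-<⇒< lt = ℕ.≰⇒> λ y≤x → ℕ.<⇒≱ lt (/-monoˡ-≤ k y≤x)

  dist≮⇒+≤ : ∀ {x y} → x ≤ y → ¬ (dist x y < k) → x + k ≤ y
  dist≮⇒+≤ {x} x≤y ¬close with t , refl ← ℕ.m≤n⇒∃[o]m+o≡n x≤y rewrite dist-+ x t =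
    ℕ.+-monoʳ-≤ x (ℕ.≮⇒≥ ¬close)

ceilDiv[m*n,n]≡m : ∀ m n .{{_ : NonZero n}} → ceilDiv (m * n) n ≡ m
ceilDiv[m*n,n]≡m m (suc n′) = begin
  (m * n + n ∸ 1) / n ≡⟨ cong (λ x → (x ∸ 1) / n) (ℕ.+-suc (m * n) n′) ⟩
  (m * n + n′) / n    ≡⟨ +-distrib-/-∣ˡ n′ (n∣m*n m) ⟩
  m * n / n + n′ / n  ≡⟨ cong₂ _+_ (m*n/n≡m m n) (m<n⇒m/n≡0 ≤-refl) ⟩
  m + 0               ≡⟨ +-identityʳ m ⟩
  m                   ∎
  where
  open ≡-Reasoning
  n = suc n′

f0[q*k,k]≡1+q*binom2 : ∀ q′ k′ → f0 (suc (suc q′) * suc k′) (suc k′) ≡ suc (suc (suc q′) * binom2 (suc k′))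
f0[q*k,k]≡1+q*binom2 q′ k′ = begin
  f0 n k
    ≡⟨ cong (λ c → (c ∸ 2) * binom2 k + binom2 (k + 1) + binom2 (n ∸ k * (c ∸ 1) ∸ 1)) (ceilDiv[m*n,n]≡m q k) ⟩
  q′ * binom2 k + binom2 (k + 1) + binom2 (n ∸ k * suc q′ ∸ 1)
    ≡⟨ cong₂ (λ a b → q′ * binom2 k + binom2 a + binom2 (b ∸ 1)) (ℕ.+-comm k 1) last-block ⟩
  q′ * binom2 k + binom2 (suc k) + binom2 k′
    ≡⟨ cong (λ c → q′ * binom2 k + c + binom2 k′) (binom2-suc k) ⟩
  q′ * binom2 k + (k + binom2 k) + binom2 k′
    ≡⟨ cong (λ c → q′ * c + (k + c) + binom2 k′) (binom2-suc k′) ⟩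
  q′ * (k′ + binom2 k′) + (k + (k′ + binom2 k′)) + binom2 k′
    ≡⟨ collect q′ k′ (binom2 k′) ⟩
  suc (q * (k′ + binom2 k′))
    ≡⟨ cong (λ c → suc (q * c)) (binom2-suc k′) ⟨
  suc (q * binom2 k) ∎
  where
  open ≡-Reasoning
  q k n : ℕ
  q = suc (suc q′)
  k = suc k′
  n = q * k
  last-block : n ∸ k * suc q′ ≡ k
  last-block = trans (cong (n ∸_) (ℕ.*-comm k (suc q′))) (ℕ.m+n∸n≡m k (suc q′ * k))
  collect : ∀ q′ k′ x → q′ * (k′ + x) + (suc k′ + (k′ + x)) + x ≡ suc (suc (suc q′) * (k′ + x))
  collect = solve-∀

-- Degree windows

module _ {n} {k q : ℕ} {d w : Fin n → ℕ} (w<q : ∀ i → w i < q)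
         (inhabited : ∀ v → v < q → ∃ λ i → w i ≡ v)
         (separated : ∀ {i j} → w i < w j → d i + k ≤ d j) where

  private
    w+m<w : ∀ {i j} m → w i + suc (suc m) ≡ w j → w i + suc m < w j
    w+m<w {i} m eq = subst (w i + suc m <_) eq (ℕ.+-monoʳ-< (w i) (ℕ.n<1+n (suc m)))

  separated-chain : ∀ m {i j} → w i + suc m ≡ w j → d i + suc m * k ≤ d j
  separated-chain zero {i} {j} eq =
    subst (λ x → d i + x ≤ d j) (sym (+-identityʳ k)) (separated (subst (w i <_) eq (ℕ.m<m+n (w i) z<s)))
  separated-chain (suc m) {i} {j} eq
    with z , wz≡ ← inhabited (w i + suc m) (ℕ.<-trans (w+m<w m eq) (w<q j)) = begin
    d i + (k + suc m * k) ≡⟨ cong (d i +_) (ℕ.+-comm k (suc m * k)) ⟩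
    d i + (suc m * k + k) ≡⟨ ℕ.+-assoc (d i) (suc m * k) k ⟨
    d i + suc m * k + k   ≤⟨ ℕ.+-monoˡ-≤ k (separated-chain m (sym wz≡)) ⟩
    d z + k               ≤⟨ separated (subst (_< w j) (sym wz≡) (w+m<w m eq)) ⟩
    d j                   ∎
    where open ℕ.≤-Reasoning

close : ∀ {n} → ℕ → (Fin n → ℕ) → Fin n → Fin n → Bool
close k d i j = dist (d i) (d j) <ᵇ k

module Windows (q k : ℕ) .{{_ : NonZero k}} (d : Fin (q * k) → ℕ) (d<qk : ∀ i → d i < q * k) where

  window : Fin (q * k) → ℕ
  window i = d i / k

  window<q : ∀ i → window i < q
  window<q i = m<n*o⇒m/o<n (d<qk i)

  sameWindow : Fin (q * k) → Fin (q * k) → Bool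
  sameWindow i j = window i ≡ᵇ window j

  Stratified : Set
  Stratified = (∀ v → v < q → fibreSize window v ≡ k) × (∀ {i j} → window i < window j → d i + k ≤ d j)

  private
    sameWindow-sym : ∀ i j → sameWindow i j ≡ sameWindow j i
    sameWindow-sym i j = ≡ᵇ-sym (window i) (window j)

    close-sym : ∀ i j → close k d i j ≡ close k d j i
    close-sym i j = cong (_<ᵇ k) (dist-comm (d i) (d j))

    sameWindow⇒close : ∀ {i j} → T (sameWindow i j) → T (close k d i j)
    sameWindow⇒close {i} {j} same = ℕ.<⇒<ᵇ (same-quotient⇒dist< (d i) (d j) (ℕ.≡ᵇ⇒≡ _ _ same))

    sameWindow≤close : pairCount sameWindow ≤ pairCount (close k d)
    sameWindow≤close = pairCount-mono {R = sameWindow} {S = close k d} sameWindow⇒close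

    sameWindow<close : ∀ {i j} → window i ≢ window j → T (close k d i j) →
      pairCount sameWindow < pairCount (close k d)
    sameWindow<close wi≢wj = pairCount-mono-< {R = sameWindow} {S = close k d} sameWindow⇒close
      sameWindow-sym close-sym (wi≢wj ∘ cong window) (wi≢wj ∘ ℕ.≡ᵇ⇒≡ _ _)

    2*pairCount+qk≡∑squares :
      2 * pairCount sameWindow + q * k ≡ ∑[ v < q ] (fibreSize window (toℕ v) * fibreSize window (toℕ v))
    2*pairCount+qk≡∑squares =
      trans (sym (∑∑≡2*pairCount+n sameWindow-sym (≡ᵇ-refl ∘ window))) (∑∑-sameFibre window window<q)

  pairCount-sameWindow-≥ : q * binom2 k ≤ pairCount sameWindow
  pairCount-sameWindow-≥ = q*binom2≤ q k _ (subst (q * (k * k) ≤_) (sym 2*pairCount+qk≡∑squares)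
    (∑-squares-≥ {q} {k} (fibreSize window ∘ toℕ) (∑-fibreSize window window<q)))

  pairCount-sameWindow-> : ∀ v → fibreSize window (toℕ v) ≢ k → q * binom2 k < pairCount sameWindow
  pairCount-sameWindow-> v size≢k = q*binom2< q k _ (subst (q * (k * k) <_) (sym 2*pairCount+qk≡∑squares)
    (∑-squares-> {q} {k} (fibreSize window ∘ toℕ) (∑-fibreSize window window<q) v size≢k))

  close-pairs-or-stratified : q * binom2 k < pairCount (close k d) ⊎ Stratified
  close-pairs-or-stratified with all? (λ (v : Fin q) → fibreSize window (toℕ v) ℕ.≟ k)
  ... | no unbalanced =
    let v , size≢k = ¬∀⟶∃¬ q _ (λ v → fibreSize window (toℕ v) ℕ.≟ k) unbalanced in
    inj₁ (ℕ.<-≤-trans (pairCount-sameWindow-> v size≢k) sameWindow≤close)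
  ... | yes balanced with any? (λ i → any? (λ j → ¬? (window i ℕ.≟ window j) ×-dec T? (close k d i j)))
  ...   | yes (i , j , wi≢wj , close-ij) =
    inj₁ (ℕ.≤-<-trans pairCount-sameWindow-≥ (sameWindow<close wi≢wj close-ij))
  ...   | no noCrossClose = inj₂ (full , separated)
    where
    full : ∀ v → v < q → fibreSize window v ≡ k
    full v v<q = subst (λ x → fibreSize window x ≡ k) (toℕ-fromℕ< v<q) (balanced (fromℕ< v<q))
    separated : ∀ {i j} → window i < window j → d i + k ≤ d j
    separated {i} {j} wi<wj = dist≮⇒+≤ (ℕ.<⇒≤ (quotient-<⇒< wi<wj))
      (λ close-ij → noCrossClose (i , j , ℕ.<⇒≢ wi<wj , ℕ.<⇒<ᵇ close-ij))

-- h as a pair count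

length-filterᵇ-++ : ∀ {A : Set} (p : A → Bool) xs ys →
  length (filterᵇ p (xs ++ ys)) ≡ length (filterᵇ p xs) + length (filterᵇ p ys)
length-filterᵇ-++ p xs ys = trans (cong length (filter-++ (T? ∘ p) xs ys)) (length-++ (filterᵇ p xs))

length-filterᵇ-tabulate : ∀ {A : Set} {n} (p : A → Bool) (f : Fin n → A) →
  length (filterᵇ p (tabulate f)) ≡ ∑[ i < n ] 𝟙 (p (f i))
length-filterᵇ-tabulate {n = zero}  p f = refl
length-filterᵇ-tabulate {n = suc n} p f with p (f zero)
... | true  = cong suc (length-filterᵇ-tabulate p (f ∘ suc))
... | false = length-filterᵇ-tabulate p (f ∘ suc)

length-filterᵇ-cartesianProduct : ∀ {A B : Set} {m n} (p : A × B → Bool) (f : Fin m → A) (g : Fin n → B) →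
  length (filterᵇ p (cartesianProduct (tabulate f) (tabulate g))) ≡ ∑[ i < m ] ∑[ j < n ] 𝟙 (p (f i , g j))
length-filterᵇ-cartesianProduct {m = zero}      p f g = refl
length-filterᵇ-cartesianProduct {A} {B} {suc m} {n} p f g = begin
  length (filterᵇ p (firstRow ++ otherRows))
    ≡⟨ length-filterᵇ-++ p firstRow otherRows ⟩
  length (filterᵇ p firstRow) + length (filterᵇ p otherRows)
    ≡⟨ cong₂ _+_ (cong (length ∘ filterᵇ p) (map-tabulate g (f zero ,_)))
                 (length-filterᵇ-cartesianProduct p (f ∘ suc) g) ⟩
  length (filterᵇ p (tabulate ((f zero ,_) ∘ g))) + ∑[ i < m ] ∑[ j < n ] 𝟙 (p (f (suc i) , g j))
    ≡⟨ cong (_+ _) (length-filterᵇ-tabulate p ((f zero ,_) ∘ g)) ⟩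
  ∑[ i < suc m ] ∑[ j < n ] 𝟙 (p (f i , g j)) ∎
  where
  open ≡-Reasoning
  firstRow otherRows : List (A × B)
  firstRow = map (f zero ,_) (tabulate g)
  otherRows = cartesianProduct (tabulate (f ∘ suc)) (tabulate g)

<ᵇ'≡<ᵇ : ∀ m n → (m <ᵇ' n) ≡ (m <ᵇ n)
<ᵇ'≡<ᵇ zero    zero    = refl
<ᵇ'≡<ᵇ zero    (suc n) = refl
<ᵇ'≡<ᵇ (suc m) zero    = refl
<ᵇ'≡<ᵇ (suc m) (suc n) = <ᵇ'≡<ᵇ m n

h≡pairCount : ∀ {n} k (G : Graph n) → h k G ≡ pairCount (close k (degree G))
h≡pairCount {n} k G = trans (proj₂ test)
  (trans (length-filterᵇ-cartesianProduct (proj₁ test) id id)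
         (sum-cong-≗ λ i → sum-cong-≗ λ j → cong 𝟙 (test-spec i j)))
  where
  -- The pair test of `h` is local to its definition; this Σ gives it a name to reason about.
  test : Σ[ p ∈ (Fin n × Fin n → Bool) ] h k G ≡ length (filterᵇ p (cartesianProduct (allFin n) (allFin n)))
  test = _ , refl

  test-spec : ∀ i j → proj₁ test (i , j) ≡ (does (i <? j) ∧ close k (degree G) i j)
  test-spec i j rewrite <ᵇ'≡<ᵇ (toℕ i) (toℕ j) with toℕ i <ᵇ toℕ j
  ... | true  = <ᵇ'≡<ᵇ (dist (degree G i) (degree G j)) k
  ... | false = refl

module _ {n} (G : Graph n) where

  degree≡∑ : ∀ i → degree G i ≡ ∑[ j < n ] 𝟙 (adj G i j)
  degree≡∑ i = length-filterᵇ-tabulate (adj G i) id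

  neighboursIn : (Fin n → Bool) → Fin n → ℕ
  neighboursIn Q t = ∑[ b ∈ Q ] 𝟙 (adj G t b)

  -- deg t ≤ e(t, Q) + (n - |Q| - 1), written without truncated subtraction.
  degree-outside : ∀ Q {t} → Q t ≡ false → degree G t + count Q + 1 ≤ neighboursIn Q t + n
  degree-outside Q {t} Qt≡false = begin
    degree G t + count Q + 1
      ≡⟨ cong₂ (λ d e → d + count Q + e) (sym (degree≡∑ t)) (∑-𝟙≟ t) ⟨
    ∑[ j < n ] 𝟙 (adj G t j) + count Q + ∑[ j < n ] 𝟙 (does (t ≟ j))
      ≡⟨ cong (_+ _) (∑-distrib-+ (𝟙 ∘ adj G t) (𝟙 ∘ Q)) ⟨
    ∑[ j < n ] (𝟙 (adj G t j) + 𝟙 (Q j)) + ∑[ j < n ] 𝟙 (does (t ≟ j))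
      ≡⟨ ∑-distrib-+ (λ j → 𝟙 (adj G t j) + 𝟙 (Q j)) (λ j → 𝟙 (does (t ≟ j))) ⟨
    ∑[ j < n ] (𝟙 (adj G t j) + 𝟙 (Q j) + 𝟙 (does (t ≟ j)))
      ≤⟨ ∑-mono-≤ pointwise ⟩
    ∑[ j < n ] (𝟙 (Q j) * 𝟙 (adj G t j) + 1)
      ≡⟨ ∑-distrib-+ (λ j → 𝟙 (Q j) * 𝟙 (adj G t j)) (λ _ → 1) ⟩
    neighboursIn Q t + ∑[ j < n ] 1
      ≡⟨ cong (neighboursIn Q t +_) (trans (∑-const n 1) (ℕ.*-identityʳ n)) ⟩
    neighboursIn Q t + n ∎
    where
    open ℕ.≤-Reasoning
    pointwise : ∀ j → 𝟙 (adj G t j) + 𝟙 (Q j) + 𝟙 (does (t ≟ j)) ≤ 𝟙 (Q j) * 𝟙 (adj G t j) + 1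
    pointwise j with t ≟ j
    ... | yes refl rewrite irrefl G t | Qt≡false = ≤-refl
    ... | no _     = off-diagonal (adj G t j) (Q j)
      where
      off-diagonal : ∀ a b → 𝟙 a + 𝟙 b + 0 ≤ 𝟙 b * 𝟙 a + 1
      off-diagonal false false = z≤n
      off-diagonal false true  = ≤-refl
      off-diagonal true  false = ≤-refl
      off-diagonal true  true  = ≤-refl

  degree<n : ∀ i → degree G i < n
  degree<n i = begin-strict
    degree G i               ≡⟨ +-identityʳ (degree G i) ⟨
    degree G i + 0           ≡⟨ cong (degree G i +_) (sum-replicate-zero n) ⟨
    degree G i + count ∅     <⟨ ℕ.m<m+n _ z<s ⟩
    degree G i + count ∅ + 1 ≤⟨ degree-outside ∅ refl ⟩
    neighboursIn ∅ i + n     ≡⟨ cong (_+ n) (sum-replicate-zero n) ⟩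
    n                        ∎
    where
    open ℕ.≤-Reasoning
    ∅ : Fin n → Bool
    ∅ _ = false

  ∑-neighboursIn-≤ : ∀ P Q → ∑[ t ∈ P ] neighboursIn Q t ≤ ∑[ b ∈ Q ] degree G b
  ∑-neighboursIn-≤ P Q = begin
    ∑[ t ∈ P ] neighboursIn Q t
      ≡⟨ sum-cong-≗ (λ t → *-distribˡ-sum (𝟙 (P t)) (λ b → 𝟙 (Q b) * 𝟙 (adj G t b))) ⟩
    ∑[ t < n ] ∑[ b < n ] (𝟙 (P t) * (𝟙 (Q b) * 𝟙 (adj G t b)))
      ≡⟨ ∑-comm (λ t b → 𝟙 (P t) * (𝟙 (Q b) * 𝟙 (adj G t b))) ⟩
    ∑[ b < n ] ∑[ t < n ] (𝟙 (P t) * (𝟙 (Q b) * 𝟙 (adj G t b)))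
      ≤⟨ ∑-mono-≤ (λ b → ∑-mono-≤ (λ t → pointwise b t)) ⟩
    ∑[ b < n ] ∑[ t < n ] (𝟙 (Q b) * 𝟙 (adj G b t))
      ≡⟨ sum-cong-≗ (λ b → trans (cong (𝟙 (Q b) *_) (degree≡∑ b)) (*-distribˡ-sum (𝟙 (Q b)) (𝟙 ∘ adj G b))) ⟨
    ∑[ b ∈ Q ] degree G b ∎
    where
    open ℕ.≤-Reasoning
    pointwise : ∀ b t → 𝟙 (P t) * (𝟙 (Q b) * 𝟙 (adj G t b)) ≤ 𝟙 (Q b) * 𝟙 (adj G b t)
    pointwise b t rewrite adj-sym G t b = 𝟙*-≤ (P t) _

  ¬dominated : ∀ P Q → count P ≡ count Q → 0 < count Q →
    ¬ (∀ {t b} → T (P t) → T (Q b) → degree G b < neighboursIn Q t)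
  ¬dominated P Q |P|≡|Q| 0<|Q| dominated =
    ℕ.<⇒≱ (0<m⇒0<m*m 0<|Q|) (ℕ.+-cancelʳ-≤ (c * D) (c * c) 0 (begin
      c * c + c * D                         ≡⟨ ℕ.*-distribˡ-+ c c D ⟨
      c * (c + D)                           ≡⟨ cong₂ _*_ |P|≡|Q| (∑∈-suc Q (degree G)) ⟨
      count P * ∑[ b ∈ Q ] suc (degree G b) ≤⟨ ∑∈-cross-≤ P Q (suc ∘ degree G) (neighboursIn Q) dominated ⟩
      c * ∑[ t ∈ P ] neighboursIn Q t       ≤⟨ ℕ.*-monoʳ-≤ c (∑-neighboursIn-≤ P Q) ⟩
      c * D                                 ∎))
    where
    open ℕ.≤-Reasoning
    c D : ℕ
    c = count Q
    D = ∑[ b ∈ Q ] degree G b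

module _ (q′ k : ℕ) .{{_ : NonZero k}} (G : Graph (suc (suc q′) * k)) where

  open Windows (suc (suc q′)) k (degree G) (degree<n G)

  ¬stratified : ¬ Stratified
  ¬stratified (full , separated) = ¬dominated G top bottom |top|≡|bottom| 0<|bottom| dominated
    where
    top bottom : Fin (suc (suc q′) * k) → Bool
    top    i = window i ≡ᵇ suc q′
    bottom i = window i ≡ᵇ 0

    |bottom|≡k : count bottom ≡ k
    |bottom|≡k = full 0 z<s

    |top|≡|bottom| : count top ≡ count bottom
    |top|≡|bottom| = trans (full (suc q′) ≤-refl) (sym |bottom|≡k)

    0<|bottom| : 0 < count bottom
    0<|bottom| = subst (0 <_) (sym |bottom|≡k) (>-nonZero⁻¹ k)

    inhabited : ∀ v → v < suc (suc q′) → ∃ λ i → window i ≡ v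
    inhabited v v<q = fibre-inhabited window (subst (0 <_) (sym (full v v<q)) (>-nonZero⁻¹ k))

    dominated : ∀ {t b} → T (top t) → T (bottom b) → degree G b < neighboursIn G bottom t
    dominated {t} {b} t∈top b∈bottom = ℕ.+-cancelʳ-≤ (k + suc q′ * k) (suc (degree G b)) _ (begin
      suc (degree G b) + (k + suc q′ * k)    ≡⟨ rearrange (degree G b) k (suc q′ * k) ⟩
      degree G b + suc q′ * k + (k + 1)      ≤⟨ ℕ.+-monoˡ-≤ (k + 1) (separated-chain window<q inhabited separated q′ wb+q≡wt) ⟩
      degree G t + (k + 1)                   ≡⟨ cong (λ c → degree G t + (c + 1)) |bottom|≡k ⟨
      degree G t + (count bottom + 1)        ≡⟨ ℕ.+-assoc (degree G t) (count bottom) 1 ⟨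
      degree G t + count bottom + 1          ≤⟨ degree-outside G bottom (cong (_≡ᵇ 0) wt≡) ⟩
      neighboursIn G bottom t + (k + suc q′ * k) ∎)
      where
      open ℕ.≤-Reasoning
      rearrange : ∀ a k m → suc a + (k + m) ≡ a + m + (k + 1)
      rearrange = solve-∀
      wt≡ : window t ≡ suc q′
      wt≡ = ℕ.≡ᵇ⇒≡ _ _ t∈top
      wb+q≡wt : window b + suc q′ ≡ window t
      wb+q≡wt = trans (cong (_+ suc q′) (ℕ.≡ᵇ⇒≡ _ _ b∈bottom)) (sym wt≡)

theorem4 : (n k : ℕ) .{{_ : NonZero k}} → k < n → k ∣ n →
    (G : Graph n) → f0 n k ≤ h k G
theorem4 .(0 * suc k′) (suc k′) () (divides 0 refl) G
theorem4 .(1 * suc k′) (suc k′) k<k (divides 1 refl) G = ⊥-elim (ℕ.<-irrefl (sym (+-identityʳ _)) k<k)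
theorem4 .(suc (suc q′) * suc k′) (suc k′) _ (divides (suc (suc q′)) refl) G = begin
  f0 (q * k) k                   ≡⟨ f0[q*k,k]≡1+q*binom2 q′ k′ ⟩
  suc (q * binom2 k)             ≤⟨ [ id , ⊥-elim ∘ ¬stratified q′ k G ]′ close-pairs-or-stratified ⟩
  pairCount (close k (degree G)) ≡⟨ h≡pairCount k G ⟨
  h k G                          ∎
  where
  open ℕ.≤-Reasoning
  q k : ℕ
  q = suc (suc q′)
  k = suc k′
  open Windows q k (degree G) (degree<n G)
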